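{- Let $p$ be an odd prime and let $\tilde G$ be the graph (possibly with loops) on vertex set $\mathbb{F}_p^2$ in which $(a,c)$ and $(b,d)$ are adjacent if and only if $ab=c+d$. For $a\in\mathbb{F}_p$ let $P_a=\{(a,c):c\in\mathbb{F}_p\}$. Then: (1) for distinct $a,b\in\mathbb{F}_p$, the edges of $\tilde G$ between $P_a$ and $P_b$ form a perfect matching; (2) for $a\in\mathbb{F}_p$, the subgraph of $\tilde G$ spanned by $P_a$ consists of a perfect matching on $p-1$ vertices and the remaining single vertex with a loop; (3) for distinct $a,b\in\mathbb{F}_p$, every pair consisting of a vertex from $P_a$ and a vertex from $P_b$ has a unique common neighbor in $\tilde G$; (4) for $a\in\mathbb{F}_p$, no pair of different vertices from $P_a$ has a common neighbor in $\tilde G$.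
   Context: $\mathbb{F}_p$ is the finite field with $p$ elements. A vertex $(a,c)$ has a loop in $\tilde G$ when $a^2=2c$. -}

module Defs where

open import Data.Nat using (ℕ; _+_; _*_; _%_)
open import Data.Nat.Primality using (Prime; prime⇒nonZero)
open import Data.Fin using (Fin; toℕ)
open import Data.Product using (_×_; _,_)
open import Relation.Binary.PropositionalEquality using (_≡_)

-- F_p is modelled as Fin p (residues 0..p-1); arithmetic is ℕ-arithmetic mod p.
-- Vertices of G̃ : F_p × F_p, the pair (a , c).
Vertex : ℕ → Set
Vertex p = Fin p × Fin p

Adj : (p : ℕ) → Prime p → Vertex p → Vertex p → Set
Adj p pr (a , c) (b , d) =
  _%_ (toℕ a * toℕ b) p {{prime⇒nonZero pr}} ≡ _%_ (toℕ c + toℕ d) p {{prime⇒nonZero pr}}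

module Submission where

-- For odd
-- n, 2 is invertible, so doubling is injective; for prime n, Bézout gives
-- multiplicative inverses, hence a ≉ b makes  a x + d ≈ b x + c  have a
-- unique solution class.  Adjacency is symmetric,
-- a common neighbour of (a,c) and (a,c') forces c = c' (giving (4)), and
-- every vertex has exactly one neighbour in each column P_b (giving (1)).
-- In P_a the looped vertex is c₀ = a²/2 and the unique-neighbour function
-- is the matching of (2).  For a ≠ b, (x,y) is a common neighbour of
-- (a,c),(b,d) iff (a,c) ~ (x,y) and a x + d ≈ b x + c, whence (3).

open import Defs
open import Data.Nat using (ℕ; _%_; _+_; _*_; _∸_; _/_; NonZero; >-nonZero⁻¹)
open import Data.Nat.Properties
  using (+-assoc; +-comm; +-identityʳ; *-comm; *-identityˡ; *-distribˡ-+; *-distribʳ-+; m+[n∸m]≡n; m∸n+n≡m)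
open import Data.Nat.DivMod
  using (%-distribˡ-+; %-distribˡ-*; m%n%n≡m%n; [m+kn]%n≡m%n; m%n≤n; m%n<n; m*n%n≡0; m<n⇒m%n≡m; m≡m%n+[m/n]*n)
open import Data.Nat.Divisibility using (n∣m⇒m%n≡0)
open import Data.Nat.Primality using (Prime; prime⇒nonZero; prime⇒irreducible)
open import Data.Nat.GCD using (module GCD; module Bézout)
open import Data.Fin using (Fin; toℕ; fromℕ<)
open import Data.Fin.Properties using (toℕ-injective; toℕ<n; toℕ-fromℕ<)
open import Data.Sum using (inj₁; inj₂)
open import Data.Empty using (⊥-elim)
open import Data.Nat.Tactic.RingSolver using (solve)
open import Data.List using (_∷_; [])
open import Data.Product using (Σ; _×_; _,_; proj₁; proj₂)
open import Function.Bundles using (_⇔_; mk⇔; Equivalence)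
open import Function.Properties.Equivalence using (⇔-setoid)
open import Level using (0ℓ)
open import Relation.Binary.PropositionalEquality using (_≡_; _≢_; refl; sym; trans; cong; cong₂; subst; setoid)
open import Relation.Binary.Bundles using (Setoid)
import Relation.Binary.Construct.On as On
import Relation.Binary.Reasoning.Setoid as SetoidReasoning
open import Relation.Nullary using (¬_)

open Equivalence using (to; from)

module Modular (n : ℕ) .{{_ : NonZero n}} where

  infix 4 _≈_
  _≈_ : ℕ → ℕ → Set
  x ≈ y = x % n ≡ y % n

  ≈-setoid : Setoid 0ℓ 0ℓ
  ≈-setoid = On.setoid {B = ℕ} (setoid ℕ) (_% n)

  open SetoidReasoning ≈-setoid

  ≈-reflexive : ∀ {x y} → x ≡ y → x ≈ y
  ≈-reflexive = cong (_% n)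

  +-cong : ∀ {x x' y y'} → x ≈ x' → y ≈ y' → x + y ≈ x' + y'
  +-cong {x} {x'} {y} {y'} x≈x' y≈y' = begin
    x + y              ≈⟨ %-distribˡ-+ x y n ⟩
    x % n + y % n      ≡⟨ cong₂ _+_ x≈x' y≈y' ⟩
    x' % n + y' % n    ≈⟨ %-distribˡ-+ x' y' n ⟨
    x' + y'            ∎

  *-cong : ∀ {x x' y y'} → x ≈ x' → y ≈ y' → x * y ≈ x' * y'
  *-cong {x} {x'} {y} {y'} x≈x' y≈y' = begin
    x * y              ≈⟨ %-distribˡ-* x y n ⟩
    x % n * (y % n)    ≡⟨ cong₂ _*_ x≈x' y≈y' ⟩
    x' % n * (y' % n)  ≈⟨ %-distribˡ-* x' y' n ⟨
    x' * y'            ∎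

  %-≈ : ∀ x → x % n ≈ x
  %-≈ x = m%n%n≡m%n x n

  +-multiple : ∀ x k → x + k * n ≈ x
  +-multiple x k = [m+kn]%n≡m%n x k n

  multiple≈0 : ∀ k → k * n ≈ 0
  multiple≈0 = +-multiple 0

  neg : ℕ → ℕ
  neg x = n ∸ x % n

  +-neg : ∀ x → x + neg x ≈ 0
  +-neg x = begin
    x + neg x          ≈⟨ +-cong (%-≈ x) refl ⟨
    x % n + neg x      ≡⟨ m+[n∸m]≡n (m%n≤n x n) ⟩
    n                  ≡⟨ *-identityˡ n ⟨
    1 * n              ≈⟨ multiple≈0 1 ⟩
    0                  ∎

  +-neg-cancel : ∀ u v → u + v + neg v ≈ u
  +-neg-cancel u v = begin
    u + v + neg v      ≡⟨ +-assoc u v (neg v) ⟩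
    u + (v + neg v)    ≈⟨ +-cong {u} refl (+-neg v) ⟩
    u + 0              ≡⟨ +-identityʳ u ⟩
    u                  ∎

  neg-+-cancel : ∀ u v → u + neg v + v ≈ u
  neg-+-cancel u v = begin
    u + neg v + v      ≡⟨ +-assoc u (neg v) v ⟩
    u + (neg v + v)    ≡⟨ cong (u +_) (+-comm (neg v) v) ⟩
    u + (v + neg v)    ≡⟨ +-assoc u v (neg v) ⟨
    u + v + neg v      ≈⟨ +-neg-cancel u v ⟩
    u                  ∎

  move : ∀ u v w → (u + v ≈ w) ⇔ (u ≈ w + neg v)
  move u v w = mk⇔
    (λ u+v≈w → trans (sym (+-neg-cancel u v)) (+-cong u+v≈w refl))
    (λ u≈w-v → trans (+-cong u≈w-v refl) (neg-+-cancel w v))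

  difference≈0 : ∀ a b → a + neg b ≈ 0 → a ≈ b
  difference≈0 a b a-b≈0 = trans (sym (neg-+-cancel a b)) (+-cong a-b≈0 refl)

  difference-* : ∀ a b x → (a + neg b) * x + b * x ≈ a * x
  difference-* a b x = begin
    (a + neg b) * x + b * x   ≡⟨ *-distribʳ-+ x (a + neg b) b ⟨
    (a + neg b + b) * x       ≈⟨ *-cong (neg-+-cancel a b) refl ⟩
    a * x                     ∎

  ≈-resp : ∀ {u u' v v'} → u ≈ u' → v ≈ v' → (u ≈ v) ⇔ (u' ≈ v')
  ≈-resp u≈u' v≈v' = mk⇔ (λ u≈v → trans (sym u≈u') (trans u≈v v≈v'))
                         (λ u'≈v' → trans u≈u' (trans u'≈v' (sym v≈v')))

  +-cancelʳ : ∀ u v z → (u + z ≈ v + z) ⇔ (u ≈ v)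
  +-cancelʳ u v z = mk⇔ cancel (λ u≈v → +-cong u≈v refl)
    where
    cancel : u + z ≈ v + z → u ≈ v
    cancel u+z≈v+z = trans (to (move u z (v + z)) u+z≈v+z) (sym (to (move v z (v + z)) refl))

  subtract : ∀ t c → c + (t + neg c) ≈ t
  subtract t c = trans (≈-reflexive (+-comm c (t + neg c))) (from (move (t + neg c) c t) refl)

  represent : ℕ → Fin n
  represent x = fromℕ< (m%n<n x n)

  represent-≈ : ∀ x → toℕ (represent x) ≈ x
  represent-≈ x = trans (≈-reflexive (toℕ-fromℕ< (m%n<n x n))) (%-≈ x)

  toℕ-≈-injective : ∀ {i j : Fin n} → toℕ i ≈ toℕ j → i ≡ j
  toℕ-≈-injective {i} {j} i≈j =
    toℕ-injective (trans (sym (m<n⇒m%n≡m (toℕ<n i))) (trans i≈j (m<n⇒m%n≡m (toℕ<n j))))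

  solve-by-unit : ∀ {e i} → e * i ≈ 1 → ∀ x r → (e * x ≈ r) ⇔ (x ≈ i * r)
  solve-by-unit {e} {i} ei≈1 x r = mk⇔ forward backward
    where
    forward : e * x ≈ r → x ≈ i * r
    forward ex≈r = begin
      x                  ≡⟨ *-identityˡ x ⟨
      1 * x              ≈⟨ *-cong ei≈1 refl ⟨
      e * i * x          ≡⟨ solve (e ∷ i ∷ x ∷ []) ⟩
      i * (e * x)        ≈⟨ *-cong {i} refl ex≈r ⟩
      i * r              ∎
    backward : x ≈ i * r → e * x ≈ r
    backward x≈ir = begin
      e * x              ≈⟨ *-cong {e} refl x≈ir ⟩
      e * (i * r)        ≡⟨ solve (e ∷ i ∷ r ∷ []) ⟩
      e * i * r          ≈⟨ *-cong ei≈1 refl ⟩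
      1 * r              ≡⟨ *-identityˡ r ⟩
      r                  ∎

  negated-inverse : ∀ e x → 1 + x * e ≈ 0 → e * (x * (n ∸ 1)) ≈ 1
  negated-inverse e x 1+xe≈0 = begin
    e * (x * m)                 ≈⟨ +-multiple (e * (x * m)) 1 ⟨
    e * (x * m) + 1 * n         ≡⟨ cong (λ k → e * (x * m) + 1 * k) m+1≡n ⟨
    e * (x * m) + 1 * (m + 1)   ≡⟨ rearrange m ⟩
    (1 + x * e) * m + 1         ≈⟨ +-cong (*-cong 1+xe≈0 refl) refl ⟩
    0 * m + 1                   ≡⟨⟩
    1                           ∎
    where
    m : ℕ
    m = n ∸ 1
    m+1≡n : m + 1 ≡ n
    m+1≡n = m∸n+n≡m (>-nonZero⁻¹ n)
    rearrange : ∀ k → e * (x * k) + 1 * (k + 1) ≡ (1 + x * e) * k + 1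
    rearrange k = solve (e ∷ x ∷ k ∷ [])

  inverse : Prime n → ∀ e → ¬ (e ≈ 0) → Σ ℕ λ i → e * i ≈ 1
  inverse pr e e≉0 with Bézout.lemma e n
  ... | Bézout.result d g identity with prime⇒irreducible pr (GCD.gcd∣n g)
  -- gcd e n is 1 or n; if it is n then n ∣ e, contradicting e ≉ 0.
  ... | inj₂ refl = ⊥-elim (e≉0 (trans (n∣m⇒m%n≡0 e n (GCD.gcd∣m g)) (sym (m*n%n≡0 0 n))))
  ... | inj₁ refl with identity
  ...   | Bézout.+- x y 1+yn≡xe = x , (begin
          e * x          ≡⟨ *-comm e x ⟩
          x * e          ≡⟨ 1+yn≡xe ⟨
          1 + y * n      ≈⟨ +-multiple 1 y ⟩
          1              ∎)
  ...   | Bézout.-+ x y 1+xe≡yn =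
          x * (n ∸ 1) , negated-inverse e x (trans (≈-reflexive 1+xe≡yn) (multiple≈0 y))

  module Odd (odd : n % 2 ≡ 1) where

    half : ℕ
    half = 1 + n / 2

    half+half≈1 : half + half ≈ 1
    half+half≈1 = begin
      half + half                 ≡⟨ double-succ (n / 2) ⟩
      1 + 1 * (1 + n / 2 * 2)     ≡⟨ cong (λ k → 1 + 1 * (k + n / 2 * 2)) odd ⟨
      1 + 1 * (n % 2 + n / 2 * 2) ≡⟨ cong (λ k → 1 + 1 * k) (m≡m%n+[m/n]*n n 2) ⟨
      1 + 1 * n                   ≈⟨ +-multiple 1 1 ⟩
      1                           ∎
      where
      double-succ : ∀ k → (1 + k) + (1 + k) ≡ 1 + 1 * (1 + k * 2)
      double-succ k = solve (k ∷ [])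

    double-half : ∀ y → half * y + half * y ≈ y
    double-half y = begin
      half * y + half * y    ≡⟨ *-distribʳ-+ y half half ⟨
      (half + half) * y      ≈⟨ *-cong half+half≈1 refl ⟩
      1 * y                  ≡⟨ *-identityˡ y ⟩
      y                      ∎

    double-injective : ∀ x y → x + x ≈ y + y → x ≈ y
    double-injective x y 2x≈2y = begin
      x                      ≈⟨ double-half x ⟨
      half * x + half * x    ≡⟨ *-distribˡ-+ half x x ⟨
      half * (x + x)         ≈⟨ *-cong {half} refl 2x≈2y ⟩
      half * (y + y)         ≡⟨ *-distribˡ-+ half y y ⟩
      half * y + half * y    ≈⟨ double-half y ⟩
      y                      ∎

module LinearEquation (n : ℕ) .{{_ : NonZero n}} (pr : Prime n) where

  open Modular n
  open SetoidReasoning (⇔-setoid 0ℓ)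

  linear-equation : ∀ {a b} → ¬ (a ≈ b) → ∀ c d →
                    Σ ℕ λ x₀ → ∀ x → (a * x + d ≈ b * x + c) ⇔ (x ≈ x₀)
  linear-equation {a} {b} a≉b c d = i * (c + neg d) , λ x → begin
    (a * x + d ≈ b * x + c)              ≈⟨ ≈-resp (regroup x) (≈-reflexive (+-comm (b * x) c)) ⟩
    (e * x + d + b * x ≈ c + b * x)      ≈⟨ +-cancelʳ (e * x + d) c (b * x) ⟩
    (e * x + d ≈ c)                      ≈⟨ move (e * x) d c ⟩
    (e * x ≈ c + neg d)                  ≈⟨ solve-by-unit {e} {i} ei≈1 x (c + neg d) ⟩
    (x ≈ i * (c + neg d))                ∎
    where
    e : ℕ
    e = a + neg b
    e-invertible : Σ ℕ λ i → e * i ≈ 1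
    e-invertible = inverse pr e (λ e≈0 → a≉b (difference≈0 a b e≈0))
    i : ℕ
    i = proj₁ e-invertible
    ei≈1 : e * i ≈ 1
    ei≈1 = proj₂ e-invertible
    swap : ∀ u v w → u + v + w ≡ u + w + v
    swap u v w = solve (u ∷ v ∷ w ∷ [])
    regroup : ∀ x → a * x + d ≈ e * x + d + b * x
    regroup x = sym (trans (≈-reflexive (swap (e * x) d (b * x))) (+-cong (difference-* a b x) refl))

module Graph (p : ℕ) (pr : Prime p) where

  instance
    p-nonZero : NonZero p
    p-nonZero = prime⇒nonZero pr

  open Modular p
  open LinearEquation p pr
  open SetoidReasoning ≈-setoid

  infix 4 _~_
  _~_ : Vertex p → Vertex p → Set
  _~_ = Adj p pr

  Unique : (Fin p → Set) → Set
  Unique P = Σ (Fin p) λ d → P d × ((d' : Fin p) → P d' → d' ≡ d)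

  ~-sym : ∀ {u v} → u ~ v → v ~ u
  ~-sym {a , c} {b , d} ac~bd =
    trans (≈-reflexive (*-comm (toℕ b) (toℕ a))) (trans ac~bd (≈-reflexive (+-comm (toℕ c) (toℕ d))))

  column-common-neighbour : ∀ {a c c' w} → (a , c) ~ w → (a , c') ~ w → c ≡ c'
  column-common-neighbour {c = c} {c'} {_ , d} ac~w ac'~w =
    toℕ-≈-injective (to (+-cancelʳ (toℕ c) (toℕ c') (toℕ d)) (trans (sym ac~w) ac'~w))

  neighbour-unique : ∀ {u b d d'} → u ~ (b , d) → u ~ (b , d') → d ≡ d'
  neighbour-unique {u} {b} {d} {d'} u~bd u~bd' =
    column-common-neighbour {b} {d} {d'} {u} (~-sym {u} {b , d} u~bd) (~-sym {u} {b , d'} u~bd')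

  neighbour-in-column : (u : Vertex p) (b : Fin p) → Unique λ d → u ~ (b , d)
  neighbour-in-column (a , c) b = d , ac~bd , λ d' ac~bd' → neighbour-unique {a , c} {b} ac~bd' ac~bd
    where
    d : Fin p
    d = represent (toℕ a * toℕ b + neg (toℕ c))
    ac~bd : (a , c) ~ (b , d)
    ac~bd = sym (trans (+-cong {toℕ c} refl (represent-≈ _)) (subtract _ (toℕ c)))

  columns-matched : (a b : Fin p) →
    ((c : Fin p) → Unique λ d → (a , c) ~ (b , d)) × ((d : Fin p) → Unique λ c → (a , c) ~ (b , d))
  columns-matched a b = (λ c → neighbour-in-column (a , c) b) , partner
    where
    partner : (d : Fin p) → Unique λ c → (a , c) ~ (b , d)
    partner d with neighbour-in-column (b , d) a
    ... | c , bd~ac , _ = c , ~-sym {b , d} {a , c} bd~ac , λ c' ac'~bd →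
      column-common-neighbour {a} {c'} {c} {b , d} ac'~bd (~-sym {b , d} {a , c} bd~ac)

  no-common-neighbour : (a c c' : Fin p) → c ≢ c' → ¬ (Σ (Vertex p) λ w → (a , c) ~ w × (a , c') ~ w)
  no-common-neighbour a c c' c≢c' (w , ac~w , ac'~w) =
    c≢c' (column-common-neighbour {a} {c} {c'} {w} ac~w ac'~w)

  module Column (odd : p % 2 ≡ 1) (a : Fin p) where

    open Odd odd

    looped : Fin p
    looped = represent (half * (toℕ a * toℕ a))

    loop : (a , looped) ~ (a , looped)
    loop = begin
      A * A                    ≈⟨ double-half (A * A) ⟨
      half * (A * A) + half * (A * A)
                               ≈⟨ +-cong (represent-≈ (half * (A * A))) (represent-≈ (half * (A * A))) ⟨
      toℕ looped + toℕ looped  ∎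
      where
      A : ℕ
      A = toℕ a

    loop-unique : ∀ {c} → (a , c) ~ (a , c) → c ≡ looped
    loop-unique {c} c-loop = toℕ-≈-injective (double-injective (toℕ c) (toℕ looped) (trans (sym c-loop) loop))

    matched : ∀ c → c ≢ looped → Σ (Fin p) λ d →
      d ≢ c × d ≢ looped × (a , c) ~ (a , d) × ((d' : Fin p) → (a , c) ~ (a , d') → d' ≡ d)
    matched c c≢looped = d , d≢c , d≢looped , ac~ad , unique
      where
      partner : Unique λ d → (a , c) ~ (a , d)
      partner = neighbour-in-column (a , c) a
      d : Fin p
      d = proj₁ partner
      ac~ad : (a , c) ~ (a , d)
      ac~ad = proj₁ (proj₂ partner)
      unique : (d' : Fin p) → (a , c) ~ (a , d') → d' ≡ d
      unique = proj₂ (proj₂ partner)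
      d≢c : d ≢ c
      d≢c d≡c = c≢looped (loop-unique {c} (subst (λ e → (a , c) ~ (a , e)) d≡c ac~ad))
      d≢looped : d ≢ looped
      d≢looped d≡looped =
        c≢looped (column-common-neighbour {a} {c} {looped} {a , looped}
                   (subst (λ e → (a , c) ~ (a , e)) d≡looped ac~ad) loop)

  column-structure : p % 2 ≡ 1 → (a : Fin p) → Σ (Fin p) λ c₀ →
    (a , c₀) ~ (a , c₀)
    × ((d : Fin p) → (a , c₀) ~ (a , d) → d ≡ c₀)
    × ((c : Fin p) → c ≢ c₀ → Σ (Fin p) λ d →
        d ≢ c × d ≢ c₀ × (a , c) ~ (a , d) × ((d' : Fin p) → (a , c) ~ (a , d') → d' ≡ d))
  column-structure odd a = looped , loop , (λ d c₀~d → neighbour-unique {a , looped} {a} c₀~d loop) , matched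
    where open Column odd a

  -- Given (a,c) ~ (x,y), the vertex (b,d) is adjacent to (x,y) iff x solves
  -- a x + d ≈ b x + c; this eliminates y from the common-neighbour problem.
  second-neighbour : ∀ {a b c d x y} → (a , c) ~ (x , y) →
                     ((b , d) ~ (x , y)) ⇔ (toℕ a * toℕ x + toℕ d ≈ toℕ b * toℕ x + toℕ c)
  second-neighbour {a} {b} {c} {d} {x} {y} ac~xy = mk⇔ forward backward
    where
    A B C D X Y : ℕ
    A = toℕ a; B = toℕ b; C = toℕ c; D = toℕ d; X = toℕ x; Y = toℕ y
    exchange : ∀ u v w → u + v + w ≡ w + v + u
    exchange u v w = solve (u ∷ v ∷ w ∷ [])
    forward : (b , d) ~ (x , y) → A * X + D ≈ B * X + C
    forward bd~xy = begin
      A * X + D          ≈⟨ +-cong ac~xy (refl {x = D % p}) ⟩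
      C + Y + D          ≡⟨ exchange C Y D ⟩
      D + Y + C          ≈⟨ +-cong bd~xy (refl {x = C % p}) ⟨
      B * X + C          ∎
    backward : A * X + D ≈ B * X + C → (b , d) ~ (x , y)
    backward equation = to (+-cancelʳ (B * X) (D + Y) C) (begin
      B * X + C          ≈⟨ equation ⟨
      A * X + D          ≈⟨ +-cong ac~xy (refl {x = D % p}) ⟩
      C + Y + D          ≡⟨ exchange C Y D ⟩
      D + Y + C          ∎)

  common-neighbour : ∀ {a b} → a ≢ b → (c d : Fin p) →
    Σ (Vertex p) λ w → ((a , c) ~ w × (b , d) ~ w)
      × ((w' : Vertex p) → (a , c) ~ w' → (b , d) ~ w' → w' ≡ w)
  common-neighbour {a} {b} a≢b c d = (x , y) , (ac~xy , bd~xy) , unique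
    where
    solution : Σ ℕ λ x₀ → ∀ X → (toℕ a * X + toℕ d ≈ toℕ b * X + toℕ c) ⇔ (X ≈ x₀)
    solution = linear-equation (λ a≈b → a≢b (toℕ-≈-injective a≈b)) (toℕ c) (toℕ d)
    x : Fin p
    x = represent (proj₁ solution)
    y : Fin p
    y = proj₁ (neighbour-in-column (a , c) x)
    ac~xy : (a , c) ~ (x , y)
    ac~xy = proj₁ (proj₂ (neighbour-in-column (a , c) x))
    bd~xy : (b , d) ~ (x , y)
    bd~xy = from (second-neighbour {a} {b} {c} {d} ac~xy) (from (proj₂ solution (toℕ x)) (represent-≈ _))
    unique : (w' : Vertex p) → (a , c) ~ w' → (b , d) ~ w' → w' ≡ (x , y)
    unique (x' , y') ac~w' bd~w' = cong₂ _,_ x'≡x y'≡y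
      where
      x'≡x : x' ≡ x
      x'≡x = toℕ-≈-injective
        (trans (to (proj₂ solution (toℕ x')) (to (second-neighbour {a} {b} {c} {d} {x'} {y'} ac~w') bd~w'))
               (sym (represent-≈ _)))
      y'≡y : y' ≡ y
      y'≡y = neighbour-unique {a , c} {x} (subst (λ e → (a , c) ~ (e , y')) x'≡x ac~w') ac~xy

lemmaA1 : (p : ℕ) (pr : Prime p) → p % 2 ≡ 1 →
  -- (1) edges between P_a and P_b (a ≠ b) form a perfect matching
  ((a b : Fin p) → a ≢ b →
    ((c : Fin p) → Σ (Fin p) λ d → Adj p pr (a , c) (b , d)
        × ((d' : Fin p) → Adj p pr (a , c) (b , d') → d' ≡ d))
    × ((d : Fin p) → Σ (Fin p) λ c → Adj p pr (a , c) (b , d)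
        × ((c' : Fin p) → Adj p pr (a , c') (b , d) → c' ≡ c)))
  -- (2) inside P_a: one looped vertex c₀ with no other neighbour in P_a,
  --     and a perfect matching on the remaining p - 1 vertices
  × ((a : Fin p) → Σ (Fin p) λ c₀ →
      Adj p pr (a , c₀) (a , c₀)
      × ((d : Fin p) → Adj p pr (a , c₀) (a , d) → d ≡ c₀)
      × ((c : Fin p) → c ≢ c₀ → Σ (Fin p) λ d →
          d ≢ c × d ≢ c₀ × Adj p pr (a , c) (a , d)
          × ((d' : Fin p) → Adj p pr (a , c) (a , d') → d' ≡ d)))
  -- (3) for a ≠ b, any u ∈ P_a, v ∈ P_b have a unique common neighbour
  × ((a b : Fin p) → a ≢ b → (c d : Fin p) →
      Σ (Vertex p) λ w → (Adj p pr (a , c) w × Adj p pr (b , d) w)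
        × ((w' : Vertex p) → Adj p pr (a , c) w' → Adj p pr (b , d) w' → w' ≡ w))
  -- (4) distinct vertices of the same P_a have no common neighbour
  × ((a c c' : Fin p) → c ≢ c' →
      ¬ (Σ (Vertex p) λ w → Adj p pr (a , c) w × Adj p pr (a , c') w))
lemmaA1 p pr odd =
  (λ a b _ → columns-matched a b) , column-structure odd , (λ a b → common-neighbour) , no-common-neighbour
  where open Graph p pr
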